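{- Let $k\geq 2$ and let $G_1,\dots,G_k$ be connected graphs, and let $G^*=G_1\Box G_2\Box\cdots\Box G_k$ be their Cartesian product. Then $$rx_3(G^*)\leq \sum_{i=1}^{k} rx_3(G_i).$$ Moreover, if $rx_3(G_i)=sdiam_3(G_i)$ for each $i$, then equality holds.
   Context: All graphs are simple, connected, undirected. In an edge-colored graph (adjacent edges may share colors), a tree is a rainbow tree if no two of its edges have the same color. An edge coloring of $G$ is a $3$-rainbow coloring if for every set $S$ of $3$ vertices of $G$ there is a rainbow tree in $G$ containing $S$; $rx_3(G)$, the $3$-rainbow index, is the minimum number of colors in a $3$-rainbow coloring of $G$. The Steiner distance $d(S)$ of a vertex set $S$ is the minimum number of edges of a tree in $G$ containing $S$; $sdiam_3(G)$ is the maximum of $d(S)$ over all $3$-element vertex sets $S$. The Cartesian product $G\Box H$ has vertex set $V(G)\times V(H)$, with $(g_1,h_1)$ and $(g_2,h_2)$ adjacent iff either $g_1=g_2$ and $h_1h_2\in E(H)$, or $h_1=h_2$ and $g_1g_2\in E(G)$. -}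

module Defs where

open import Level using (0ℓ)
open import Data.Nat using (ℕ; zero; suc; _+_; _*_; _≤_)
open import Data.Fin using (Fin)
open import Data.Fin.Properties using (*↔×; 1↔⊤)
open import Data.Unit using (⊤; tt)
open import Data.Empty using (⊥)
open import Data.Product using (Σ; Σ-syntax; ∃; ∃-syntax; _×_; _,_; proj₁; proj₂)
open import Data.Product.Properties using (≡-dec)
open import Data.Product.Function.NonDependent.Propositional using (_×-↔_)
open import Data.Sum using (_⊎_; inj₁; inj₂)
open import Data.List using (List; []; _∷_; length; map)
open import Data.List.Membership.Propositional using (_∈_)
open import Data.List.Relation.Unary.All using (All)
open import Data.List.Relation.Unary.AllPairs using (AllPairs)
open import Data.List.Relation.Unary.Unique.Propositional using (Unique)
open import Data.Vec using (Vec; []; _∷_)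
open import Function.Bundles using (_↔_)
open import Function.Properties.Inverse using (↔-trans; ↔-sym)
open import Relation.Binary.Definitions using (DecidableEquality)
open import Relation.Binary.PropositionalEquality using (_≡_; refl)
open import Relation.Nullary using (¬_; Dec; yes; no)
open import Relation.Nullary.Decidable using (_×-dec_; _⊎-dec_)

record Graph : Set₁ where
  field
    V       : Set
    order   : ℕ
    finite  : Fin order ↔ V
    _≟V_    : DecidableEquality V
    Adj     : V → V → Set
    adj?    : (u v : V) → Dec (Adj u v)
    sym     : ∀ {u v} → Adj u v → Adj v u
    irrefl  : ∀ {u} → ¬ Adj u u

open Graph public

data Walk (G : Graph) : V G → V G → Set where
  here : ∀ {u} → Walk G u u
  step : ∀ {u w v} → Adj G u w → Walk G w v → Walk G u v

Connected : Graph → Set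
Connected G = (u v : V G) → Walk G u v

ProdAdj : (G H : Graph) → V G × V H → V G × V H → Set
ProdAdj G H (g₁ , h₁) (g₂ , h₂) =
  (g₁ ≡ g₂ × Adj H h₁ h₂) ⊎ (h₁ ≡ h₂ × Adj G g₁ g₂)

private
  symEq : {A : Set} {x y : A} → x ≡ y → y ≡ x
  symEq refl = refl

_□_ : Graph → Graph → Graph
G □ H = record
  { V      = V G × V H
  ; order  = order G * order H
  ; finite = ↔-trans *↔× (finite G ×-↔ finite H)
  ; _≟V_   = ≡-dec (_≟V_ G) (_≟V_ H)
  ; Adj    = ProdAdj G H
  ; adj?   = λ { (g₁ , h₁) (g₂ , h₂) →
               (_≟V_ G g₁ g₂ ×-dec adj? H h₁ h₂) ⊎-dec (_≟V_ H h₁ h₂ ×-dec adj? G g₁ g₂) }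
  ; sym    = λ { (inj₁ (e , a)) → inj₁ (symEq e , sym H a)
               ; (inj₂ (e , a)) → inj₂ (symEq e , sym G a) }
  ; irrefl = λ { (inj₁ (_ , a)) → irrefl H a
               ; (inj₂ (_ , a)) → irrefl G a }
  }

-- the trivial graph K₁ (only used for the degenerate empty product)
K₁ : Graph
K₁ = record
  { V = ⊤ ; order = 1 ; finite = 1↔⊤ ; _≟V_ = λ { tt tt → yes refl }
  ; Adj = λ _ _ → ⊥ ; adj? = λ _ _ → no (λ ()) ; sym = λ () ; irrefl = λ () }

□⋆ : ∀ {k} → Vec Graph k → Graph
□⋆ []           = K₁
□⋆ (G ∷ [])     = G
□⋆ (G ∷ H ∷ Gs) = G □ □⋆ (H ∷ Gs)

-- A tree T in G is given by its vertex list and edge list (edges as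
-- ordered pairs, read as unordered), such that: vertices are distinct,
-- every listed edge is an edge of G between listed vertices, no edge is
-- listed twice, T is connected, and |V(T)| = |E(T)| + 1
-- (connected with |V| = |E| + 1 is the standard characterisation of a tree).

SameEdge : {A : Set} → A × A → A × A → Set
SameEdge (a , b) (c , d) = (a ≡ c × b ≡ d) ⊎ (a ≡ d × b ≡ c)

data Linked {A : Set} (E : List (A × A)) : A → A → Set where
  here : ∀ {u} → Linked E u u
  fwd  : ∀ {u w v} → (u , w) ∈ E → Linked E w v → Linked E u v
  bwd  : ∀ {u w v} → (w , u) ∈ E → Linked E w v → Linked E u v

record Tree (G : Graph) : Set where
  field
    verts       : List (V G)
    edges       : List (V G × V G)
    verts-uniq  : Unique verts
    edges-ok    : All (λ e → Adj G (proj₁ e) (proj₂ e) × proj₁ e ∈ verts × proj₂ e ∈ verts) edges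
    edges-uniq  : AllPairs (λ e f → ¬ SameEdge e f) edges
    connected   : ∀ {u v} → u ∈ verts → v ∈ verts → Linked edges u v
    size        : length verts ≡ suc (length edges)

open Tree public

∥_∥ : ∀ {G} → Tree G → ℕ
∥ T ∥ = length (edges T)

Contains3 : ∀ {G} → Tree G → V G → V G → V G → Set
Contains3 T x y z = x ∈ verts T × y ∈ verts T × z ∈ verts T

Distinct3 : {A : Set} → A → A → A → Set
Distinct3 x y z = ¬ x ≡ y × ¬ x ≡ z × ¬ y ≡ z

record Colouring (G : Graph) (r : ℕ) : Set where
  field
    col     : V G → V G → Fin r
    col-sym : ∀ {u v} → Adj G u v → col u v ≡ col v u

open Colouring public

Rainbow : ∀ {G r} → Colouring G r → Tree G → Set
Rainbow c T = Unique (map (λ e → col c (proj₁ e) (proj₂ e)) (edges T))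

Is3Rainbow : ∀ {G r} → Colouring G r → Set
Is3Rainbow {G} c = (x y z : V G) → Distinct3 x y z →
  Σ[ T ∈ Tree G ] (Contains3 T x y z × Rainbow c T)

Rx3 : Graph → ℕ → Set
Rx3 G r = (Σ[ c ∈ Colouring G r ] Is3Rainbow c)
        × (∀ r' → (c : Colouring G r') → Is3Rainbow c → r ≤ r')

SteinerDist : (G : Graph) → V G → V G → V G → ℕ → Set
SteinerDist G x y z d = (Σ[ T ∈ Tree G ] (Contains3 T x y z × ∥ T ∥ ≡ d))
                      × ((T : Tree G) → Contains3 T x y z → d ≤ ∥ T ∥)

Sdiam3 : Graph → ℕ → Set
Sdiam3 G D = (Σ[ x ∈ V G ] Σ[ y ∈ V G ] Σ[ z ∈ V G ] (Distinct3 x y z × SteinerDist G x y z D))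
           × (∀ x y z d → Distinct3 x y z → SteinerDist G x y z d → d ≤ D)

module Submission where

-- Upper bound.  A *spider* for x, y, z under an edge colouring is a triple
-- of walks from x, y and z to a common centre whose edges together carry
-- pairwise distinct colours.  A tree built from the edges of a spider is
-- rainbow (spider⇒rainbowTree); conversely the tree paths from x, y, z to
-- their median in a rainbow tree form a spider (rainbowTree⇒spider).  Pairs
-- of vertices borrow a third vertex, or are adjacent when they are all of G,
-- so a 3-rainbow colouring of a connected graph has spiders for all triples
-- (3rainbow⇒spiders).  Spiders of G and of H with disjoint palettes combine
-- into a spider of G □ H: walk in an H-layer to the H-centre, then in a
-- G-layer to the G-centre (product-spider).  By induction over the factors,
-- Σ rx₃(Gᵢ) colours suffice for the product (product-spiderColouring).
--
-- Lower bound.  The edges of a tree of G □ H split into G-edges and H-edges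
-- whose projections connect the projected vertices, so by the pigeonhole
-- principle a tree through (xᵢ), (yᵢ), (zᵢ) has at least Σ d(xᵢ, yᵢ, zᵢ)
-- edges (tree-size-≥).  For triples attaining sdiam₃(Gᵢ), a rainbow tree
-- through the product triple thus needs Σ sdiam₃(Gᵢ) colours
-- (product-3rainbow-≥).

open import Defs
open import Data.Nat using (ℕ; zero; suc; _+_; _≤_; z≤n; s≤s)
open import Data.Nat.Properties using (+-suc; +-identityʳ; +-mono-≤; ≤-trans; ≤-antisym; module ≤-Reasoning)
open import Data.Fin using (Fin; zero; suc; _↑ˡ_; _↑ʳ_; splitAt)
open import Data.Fin.Properties using (↑ˡ-injective; ↑ʳ-injective; splitAt-↑ˡ; splitAt-↑ʳ)
open import Data.Product using (_×_; _,_; proj₁; proj₂; Σ-syntax; swap) renaming (map to ×-map)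
open import Data.Sum using (_⊎_; inj₁; inj₂; [_,_]′)
open import Data.Empty using (⊥; ⊥-elim)
open import Data.List using (List; []; _∷_; _++_; length; map; allFin)
open import Data.List.Properties using (map-++; ++-assoc; map-∘; length-map; length-tabulate; length-removeAt′)
open import Data.List.Membership.Propositional using (_∈_; _∉_; _─_; lose)
open import Data.List.Membership.Propositional.Properties using (∈-map⁺; ∈-map⁻; ∈-++⁺ˡ; ∈-++⁺ʳ; ∈-allFin)
open import Data.List.Relation.Unary.Any using (here; there; index; any?; satisfied)
open import Data.List.Relation.Unary.All as All using (All; []; _∷_)
import Data.List.Relation.Unary.All.Properties as All
open import Data.List.Relation.Unary.AllPairs as AllPairs using (AllPairs; []; _∷_)
import Data.List.Relation.Unary.AllPairs.Properties as AllPairs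
open import Data.List.Relation.Unary.Unique.Propositional using (Unique)
import Data.List.Relation.Unary.Unique.Propositional.Properties as Unique
open import Data.List.Relation.Binary.Permutation.Propositional using (_↭_; ↭-refl; ↭-sym; ↭-trans; ↭⇒↭ₛ; module PermutationReasoning)
open import Data.List.Relation.Binary.Permutation.Propositional.Properties using (++⁺ˡ; ++⁺ʳ; ++-comm; shifts; ++-commutativeMonoid)
import Data.List.Relation.Binary.Permutation.Setoid.Properties as PermutationSetoid
open import Data.Vec using (Vec; []; _∷_; lookup; sum)
open import Function using (id; _∘_)
open import Function.Bundles using (Inverse)
open import Relation.Binary.PropositionalEquality
  using (_≡_; _≢_; refl; trans; cong; cong₂; subst; subst₂; setoid; module ≡-Reasoning)
  renaming (sym to ≡-sym)
open import Relation.Nullary using (¬_; yes; no; ¬?)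
open import Relation.Nullary.Decidable using (_×-dec_)

module _ {A : Set} where

  ∈-─ : ∀ {x a : A} {ys} (p : x ∈ ys) → a ∈ ys → a ≢ x → a ∈ ys ─ p
  ∈-─ (here refl) (here refl) a≢x = ⊥-elim (a≢x refl)
  ∈-─ (here refl) (there q)   _   = q
  ∈-─ (there p)   (here eq)   _   = here eq
  ∈-─ (there p)   (there q)   a≢x = there (∈-─ p q a≢x)

  unique-length-≤ : ∀ {xs ys : List A} → Unique xs → All (_∈ ys) xs → length xs ≤ length ys
  unique-length-≤ []           []             = z≤n
  unique-length-≤ {x ∷ xs} {ys} (x∉xs ∷ xs!) (x∈ys ∷ xs⊆ys) = begin
    suc (length xs)            ≤⟨ s≤s (unique-length-≤ xs! xs⊆ys─x) ⟩
    suc (length (ys ─ x∈ys))   ≡⟨ ≡-sym (length-removeAt′ ys (index x∈ys)) ⟩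
    length ys                  ∎
    where
    open ≤-Reasoning
    xs⊆ys─x : All (_∈ ys ─ x∈ys) xs
    xs⊆ys─x = All.zipWith (λ (x≢a , a∈ys) → ∈-─ x∈ys a∈ys (x≢a ∘ ≡-sym)) (x∉xs , xs⊆ys)

  unique-resp-↭ : ∀ {xs ys : List A} → xs ↭ ys → Unique xs → Unique ys
  unique-resp-↭ p = PermutationSetoid.Unique-resp-↭ (setoid A) (↭⇒↭ₛ p)

  unique-suffix : ∀ (pre : List A) {xs} → Unique (pre ++ xs) → Unique xs
  unique-suffix []        xs!       = xs!
  unique-suffix (_ ∷ pre) (_ ∷ xs!) = unique-suffix pre xs!

  allPairs-within : ∀ {Q : A → Set} {R S : A → A → Set} →
    (∀ {a b} → Q a → Q b → R a b → S a b) → ∀ {xs} → All Q xs → AllPairs R xs → AllPairs S xs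
  allPairs-within h []       []       = []
  allPairs-within h (q ∷ qs) (r ∷ rs) =
    All.zipWith (λ (q′ , r′) → h q q′ r′) (qs , r) ∷ allPairs-within h qs rs

module _ {A B : Set} {f : A → B} where

  map-injectiveOn : ∀ {xs} → Unique (map f xs) → ∀ {a b} → a ∈ xs → b ∈ xs → f a ≡ f b → a ≡ b
  map-injectiveOn _           (here refl) (here refl) _   = refl
  map-injectiveOn (fx∉ ∷ _)   (here refl) (there b∈)  fab = ⊥-elim (All.lookup fx∉ (∈-map⁺ f b∈) fab)
  map-injectiveOn (fx∉ ∷ _)   (there a∈)  (here refl) fab = ⊥-elim (All.lookup fx∉ (∈-map⁺ f a∈) (≡-sym fab))
  map-injectiveOn (_ ∷ fxs!)  (there a∈)  (there b∈)  fab = map-injectiveOn fxs! a∈ b∈ fab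

  unique-map : ∀ {Q : A → Set} {R : A → A → Set} →
    (∀ {a b} → Q a → Q b → R a b → f a ≢ f b) → ∀ {xs} → All Q xs → AllPairs R xs → Unique (map f xs)
  unique-map sep qs rs = AllPairs.map⁺ (allPairs-within sep qs rs)

module _ {A : Set} where

  sameEdge-refl : ∀ {e : A × A} → SameEdge e e
  sameEdge-refl = inj₁ (refl , refl)

  sameEdge-sym : ∀ {e f : A × A} → SameEdge e f → SameEdge f e
  sameEdge-sym (inj₁ (refl , refl)) = inj₁ (refl , refl)
  sameEdge-sym (inj₂ (refl , refl)) = inj₂ (refl , refl)

  sameEdge-trans : ∀ {e f g : A × A} → SameEdge e f → SameEdge f g → SameEdge e g
  sameEdge-trans (inj₁ (refl , refl)) s                    = s
  sameEdge-trans (inj₂ (refl , refl)) (inj₁ (refl , refl)) = inj₂ (refl , refl)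
  sameEdge-trans (inj₂ (refl , refl)) (inj₂ (refl , refl)) = inj₁ (refl , refl)

  sameEdge-fst : ∀ {e f : A × A} → SameEdge e f → proj₁ e ≡ proj₁ f ⊎ proj₁ e ≡ proj₂ f
  sameEdge-fst (inj₁ (p , _)) = inj₁ p
  sameEdge-fst (inj₂ (p , _)) = inj₂ p

  sameEdge-snd : ∀ {e f : A × A} → SameEdge e f → proj₂ e ≡ proj₁ f ⊎ proj₂ e ≡ proj₂ f
  sameEdge-snd (inj₁ (_ , p)) = inj₂ p
  sameEdge-snd (inj₂ (_ , p)) = inj₁ p

  linked-++ : ∀ {E : List (A × A)} {u v w} → Linked E u v → Linked E v w → Linked E u w
  linked-++ here      q = q
  linked-++ (fwd e p) q = fwd e (linked-++ p q)
  linked-++ (bwd e p) q = bwd e (linked-++ p q)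

  linked-mono : ∀ {E E′ : List (A × A)} → (∀ {e} → e ∈ E → e ∈ E′) → ∀ {u v} → Linked E u v → Linked E′ u v
  linked-mono E⊆E′ here      = here
  linked-mono E⊆E′ (fwd e p) = fwd (E⊆E′ e) (linked-mono E⊆E′ p)
  linked-mono E⊆E′ (bwd e p) = bwd (E⊆E′ e) (linked-mono E⊆E′ p)

module Trees (G : Graph) where
  open import Data.List.Membership.DecPropositional (_≟V_ G) using (_∈?_)

  Edge : Set
  Edge = V G × V G

  IsEdge : Edge → Set
  IsEdge e = Adj G (proj₁ e) (proj₂ e)

  singleton : V G → Tree G
  singleton m = record
    { verts = m ∷ [] ; edges = [] ; verts-uniq = [] ∷ [] ; edges-ok = [] ; edges-uniq = []
    ; connected = λ { (here refl) (here refl) → here } ; size = refl }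

  Joins : Edge → V G → V G → Set
  Joins e u w = e ≡ (u , w) ⊎ e ≡ (w , u)

  addLeaf : (T : Tree G) (e : Edge) {u w : V G} → Joins e u w → IsEdge e →
            u ∉ verts T → w ∈ verts T → Tree G
  addLeaf T e {u} {w} e-joins e-edge u∉T w∈T = record
    { verts      = u ∷ verts T
    ; edges      = e ∷ edges T
    ; verts-uniq = All.¬Any⇒All¬ (verts T) u∉T ∷ verts-uniq T
    ; edges-ok   = (e-edge , ends e-joins) ∷ All.map (λ (a , p , q) → a , there p , there q) (edges-ok T)
    ; edges-uniq = All.map (λ (_ , p , q) → new e-joins p q) (edges-ok T) ∷ edges-uniq T
    ; connected  = linked
    ; size       = cong suc (size T)
    }
    where
    ends : Joins e u w → proj₁ e ∈ u ∷ verts T × proj₂ e ∈ u ∷ verts T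
    ends (inj₁ refl) = here refl , there w∈T
    ends (inj₂ refl) = there w∈T , here refl

    endpoint∈T : ∀ {a b} → a ∈ verts T → b ∈ verts T → u ≡ a ⊎ u ≡ b → u ∈ verts T
    endpoint∈T a∈T _   (inj₁ refl) = a∈T
    endpoint∈T _   b∈T (inj₂ refl) = b∈T

    -- e has the endpoint u outside T, so it is none of the edges of T.
    new : ∀ {f} → Joins e u w → proj₁ f ∈ verts T → proj₂ f ∈ verts T → ¬ SameEdge e f
    new (inj₁ refl) p q s = u∉T (endpoint∈T p q (sameEdge-fst s))
    new (inj₂ refl) p q s = u∉T (endpoint∈T p q (sameEdge-snd s))

    E′ : List Edge
    E′ = e ∷ edges T

    u→w : Joins e u w → Linked E′ u w
    u→w (inj₁ refl) = fwd (here refl) here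
    u→w (inj₂ refl) = bwd (here refl) here

    w→u : Joins e u w → Linked E′ w u
    w→u (inj₁ refl) = bwd (here refl) here
    w→u (inj₂ refl) = fwd (here refl) here

    old : ∀ {p q} → Linked (edges T) p q → Linked E′ p q
    old = linked-mono there

    linked : ∀ {p q} → p ∈ u ∷ verts T → q ∈ u ∷ verts T → Linked E′ p q
    linked (here refl) (here refl) = here
    linked (here refl) (there q)   = linked-++ (u→w e-joins) (old (connected T w∈T q))
    linked (there p)   (here refl) = linked-++ (old (connected T p w∈T)) (w→u e-joins)
    linked (there p)   (there q)   = old (connected T p q)

  record Extension (E : List Edge) (T : Tree G) (u : V G) : Set where
    constructor extension
    field
      tree     : Tree G
      from-E   : All (_∈ E) (edges tree)
      reaches  : u ∈ verts tree
      extends  : ∀ {a} → a ∈ verts T → a ∈ verts tree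

  extend-by : ∀ {E T u w} (e : Edge) → Joins e u w → e ∈ E → IsEdge e → Extension E T w → Extension E T u
  extend-by {u = u} e e-joins e∈E e-edge (extension T₁ T₁⊆E w∈T₁ T⊆T₁) with u ∈? verts T₁
  ... | yes u∈T₁ = extension T₁ T₁⊆E u∈T₁ T⊆T₁
  ... | no  u∉T₁ = extension (addLeaf T₁ e e-joins e-edge u∉T₁ w∈T₁) (e∈E ∷ T₁⊆E) (here refl) (there ∘ T⊆T₁)

  extend : (E : List Edge) → All IsEdge E → (T : Tree G) → All (_∈ E) (edges T) →
           ∀ {u v} → Linked E u v → v ∈ verts T → Extension E T u
  extend E E-ok T T⊆E here        v∈T = extension T T⊆E v∈T id
  extend E E-ok T T⊆E (fwd e∈E p) v∈T =
    extend-by _ (inj₁ refl) e∈E (All.lookup E-ok e∈E) (extend E E-ok T T⊆E p v∈T)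
  extend E E-ok T T⊆E (bwd e∈E p) v∈T =
    extend-by _ (inj₂ refl) e∈E (All.lookup E-ok e∈E) (extend E E-ok T T⊆E p v∈T)

  tree-through : (E : List Edge) → All IsEdge E → ∀ {x y z m} →
                 Linked E x m → Linked E y m → Linked E z m →
                 Σ[ T ∈ Tree G ] (Contains3 T x y z × All (_∈ E) (edges T))
  tree-through E E-ok {x} {y} {z} {m} x⇝m y⇝m z⇝m =
    tree T₃ , (extends T₃ (extends T₂ (reaches T₁)) , extends T₃ (reaches T₂) , reaches T₃) , from-E T₃
    where
    open Extension
    T₁ : Extension E (singleton m) x
    T₁ = extend E E-ok (singleton m) [] x⇝m (here refl)
    T₂ : Extension E (tree T₁) y
    T₂ = extend E E-ok (tree T₁) (from-E T₁) y⇝m (extends T₁ (here refl))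
    T₃ : Extension E (tree T₂) z
    T₃ = extend E E-ok (tree T₂) (from-E T₂) z⇝m (extends T₂ (extends T₁ (here refl)))

  tree-edges-unique : (T : Tree G) → Unique (edges T)
  tree-edges-unique T = AllPairs.map (λ { ¬same refl → ¬same sameEdge-refl }) (edges-uniq T)

module Walks (G : Graph) where
  open import Data.List.Membership.DecPropositional (_≟V_ G) using (_∈?_)
  open Trees G using (Edge; IsEdge)

  edgesW : ∀ {u v} → Walk G u v → List Edge
  edgesW here               = []
  edgesW (step {u} {w} _ W) = (u , w) ∷ edgesW W

  vertsW : ∀ {u v} → Walk G u v → List (V G)
  vertsW (here {u})     = u ∷ []
  vertsW (step {u} _ W) = u ∷ vertsW W

  _++W_ : ∀ {u v w} → Walk G u v → Walk G v w → Walk G u w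
  here     ++W W′ = W′
  step a W ++W W′ = step a (W ++W W′)

  edgesW-++ : ∀ {u v w} (W : Walk G u v) (W′ : Walk G v w) → edgesW (W ++W W′) ≡ edgesW W ++ edgesW W′
  edgesW-++ here       W′ = refl
  edgesW-++ (step a W) W′ = cong (_ ∷_) (edgesW-++ W W′)

  reverseW : ∀ {u v} → Walk G u v → Walk G v u
  reverseW here       = here
  reverseW (step a W) = reverseW W ++W step (sym G a) here

  edgesW-ok : ∀ {u v} (W : Walk G u v) → All IsEdge (edgesW W)
  edgesW-ok here       = []
  edgesW-ok (step a W) = a ∷ edgesW-ok W

  walk⇒linked : ∀ {E u v} (W : Walk G u v) → All (_∈ E) (edgesW W) → Linked E u v
  walk⇒linked here       _          = here
  walk⇒linked (step a W) (e∈E ∷ W⊆E) = fwd e∈E (walk⇒linked W W⊆E)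

  start∈ : ∀ {u v} (W : Walk G u v) → u ∈ vertsW W
  start∈ here       = here refl
  start∈ (step a W) = here refl

  end∈ : ∀ {u v} (W : Walk G u v) → v ∈ vertsW W
  end∈ here       = here refl
  end∈ (step a W) = there (end∈ W)

  endpoints∈ : ∀ {u v} (W : Walk G u v) {e} → e ∈ edgesW W → proj₁ e ∈ vertsW W × proj₂ e ∈ vertsW W
  endpoints∈ (step a W) (here refl) = here refl , there (start∈ W)
  endpoints∈ (step a W) (there e∈W) = ×-map there there (endpoints∈ W e∈W)

  splitWalk : ∀ {u v a} (W : Walk G u v) → a ∈ vertsW W →
              Σ[ A ∈ Walk G u a ] Σ[ B ∈ Walk G a v ]
                (edgesW W ≡ edgesW A ++ edgesW B × Σ[ pre ∈ List (V G) ] vertsW W ≡ pre ++ vertsW B)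
  splitWalk here       (here refl) = here , here , refl , [] , refl
  splitWalk (step a W) (here refl) = here , step a W , refl , [] , refl
  splitWalk (step {u} a W) (there a∈W) with splitWalk W a∈W
  ... | A , B , edges≡ , pre , verts≡ = step a A , B , cong (_ ∷_) edges≡ , u ∷ pre , cong (u ∷_) verts≡

  record PathTo (L : List (V G)) (P : Edge → Set) (u : V G) : Set where
    constructor pathTo
    field
      {end}   : V G
      path    : Walk G u end
      end∈L   : end ∈ L
      simple  : Unique (vertsW path)
      leaves  : All (λ e → proj₁ e ∉ L) (edgesW path)
      edges-P : All P (edgesW path)

  -- Loop erasure: a walk from u into L contains such a path.  Erase the tail
  -- recursively; if u reappears on the erased tail, cut the loop back to u.
  eraseLoops : (L : List (V G)) {P : Edge → Set} → ∀ {u v} (W : Walk G u v) →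
               v ∈ L → All P (edgesW W) → PathTo L P u
  eraseLoops L here v∈L _ = pathTo here v∈L ([] ∷ []) [] []
  eraseLoops L (step {u} a W) v∈L (pe ∷ pW) with u ∈? L
  ... | yes u∈L = pathTo here u∈L ([] ∷ []) [] []
  ... | no  u∉L with eraseLoops L W v∈L pW
  ...   | pathTo R m∈L R-simple R-leaves R-P with u ∈? vertsW R
  ...     | no u∉R = pathTo (step a R) m∈L (All.¬Any⇒All¬ (vertsW R) u∉R ∷ R-simple)
                            (u∉L ∷ R-leaves) (pe ∷ R-P)
  ...     | yes u∈R with splitWalk R u∈R
  ...       | A , B , edges≡ , pre , verts≡ =
    pathTo B m∈L (unique-suffix pre (subst Unique verts≡ R-simple))
                 (All.++⁻ʳ (edgesW A) (subst (All _) edges≡ R-leaves))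
                 (All.++⁻ʳ (edgesW A) (subst (All _) edges≡ R-P))

  simple⇒edges-distinct : ∀ {u v} (W : Walk G u v) → Unique (vertsW W) →
                          AllPairs (λ e f → ¬ SameEdge e f) (edgesW W)
  simple⇒edges-distinct here _ = []
  simple⇒edges-distinct (step {u} a W) (u∉W ∷ W-simple) =
    All.tabulate u-not-later ∷ simple⇒edges-distinct W W-simple
    where
    u-not-later : ∀ {f} → f ∈ edgesW W → ¬ SameEdge (u , _) f
    u-not-later f∈W s with endpoints∈ W f∈W | sameEdge-fst s
    ... | p , _ | inj₁ eq = All.lookup u∉W p eq
    ... | _ , q | inj₂ eq = All.lookup u∉W q eq

module Colours (G : Graph) {r : ℕ} (c : Colouring G r) where
  open Trees G
  open Walks G

  colour : Edge → Fin r
  colour e = col c (proj₁ e) (proj₂ e)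

  coloursW : ∀ {u v} → Walk G u v → List (Fin r)
  coloursW W = map colour (edgesW W)

  coloursW-++ : ∀ {u v w} (W : Walk G u v) (W′ : Walk G v w) → coloursW (W ++W W′) ≡ coloursW W ++ coloursW W′
  coloursW-++ W W′ = trans (cong (map colour) (edgesW-++ W W′)) (map-++ colour (edgesW W) (edgesW W′))

  coloursW-reverse : ∀ {u v} (W : Walk G u v) → coloursW (reverseW W) ↭ coloursW W
  coloursW-reverse here = ↭-refl
  coloursW-reverse (step {u} {w} a W) = begin
    coloursW (reverseW W ++W step (sym G a) here)  ≡⟨ coloursW-++ (reverseW W) _ ⟩
    coloursW (reverseW W) ++ col c w u ∷ []         ↭⟨ ++⁺ʳ _ (coloursW-reverse W) ⟩
    coloursW W ++ col c w u ∷ []                    ↭⟨ ++-comm (coloursW W) _ ⟩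
    col c w u ∷ coloursW W                          ≡⟨ cong (_∷ coloursW W) (≡-sym (col-sym c a)) ⟩
    col c u w ∷ coloursW W                          ∎
    where open PermutationReasoning

  record Spider (x y z : V G) : Set where
    constructor spider
    field
      {centre} : V G
      leg₁     : Walk G x centre
      leg₂     : Walk G y centre
      leg₃     : Walk G z centre
      rainbow  : Unique (coloursW leg₁ ++ coloursW leg₂ ++ coloursW leg₃)

  spider-swap₁₂ : ∀ {x y z} → Spider x y z → Spider y x z
  spider-swap₁₂ (spider W₁ W₂ W₃ rb) =
    spider W₂ W₁ W₃ (unique-resp-↭ (shifts (coloursW W₁) (coloursW W₂)) rb)

  spider-swap₂₃ : ∀ {x y z} → Spider x y z → Spider x z y
  spider-swap₂₃ (spider W₁ W₂ W₃ rb) =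
    spider W₁ W₃ W₂ (unique-resp-↭ (++⁺ˡ (coloursW W₁) (++-comm (coloursW W₂) (coloursW W₃))) rb)

  -- A spider contains a rainbow tree through its three feet: a tree built
  -- from its edges uses each colour at most once.
  spider⇒rainbowTree : ∀ {x y z} → Spider x y z → Σ[ T ∈ Tree G ] (Contains3 T x y z × Rainbow c T)
  spider⇒rainbowTree {x} {y} {z} (spider W₁ W₂ W₃ rb) =
    rainbowTree (tree-through E E-ok (walk⇒linked W₁ (All.tabulate ∈-++⁺ˡ))
                  (walk⇒linked W₂ (All.tabulate (∈-++⁺ʳ (edgesW W₁) ∘ ∈-++⁺ˡ)))
                  (walk⇒linked W₃ (All.tabulate (∈-++⁺ʳ (edgesW W₁) ∘ ∈-++⁺ʳ (edgesW W₂)))))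
    where
    E : List Edge
    E = edgesW W₁ ++ edgesW W₂ ++ edgesW W₃

    E-ok : All IsEdge E
    E-ok = All.++⁺ (edgesW-ok W₁) (All.++⁺ (edgesW-ok W₂) (edgesW-ok W₃))

    E-rainbow : Unique (map colour E)
    E-rainbow = subst Unique (≡-sym (begin
      map colour E                                          ≡⟨ map-++ colour (edgesW W₁) _ ⟩
      coloursW W₁ ++ map colour (edgesW W₂ ++ edgesW W₃)    ≡⟨ cong (coloursW W₁ ++_) (map-++ colour (edgesW W₂) _) ⟩
      coloursW W₁ ++ coloursW W₂ ++ coloursW W₃             ∎)) rb
      where open ≡-Reasoning

    separated : ∀ {e f} → e ∈ E → f ∈ E → ¬ SameEdge e f → colour e ≢ colour f
    separated e∈E f∈E ¬same same-colour with map-injectiveOn E-rainbow e∈E f∈E same-colour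
    ... | refl = ¬same sameEdge-refl

    rainbowTree : Σ[ T ∈ Tree G ] (Contains3 T x y z × All (_∈ E) (edges T)) →
                  Σ[ T ∈ Tree G ] (Contains3 T x y z × Rainbow c T)
    rainbowTree (T , T∋xyz , T⊆E) = T , T∋xyz , unique-map separated T⊆E (edges-uniq T)

  -- Conversely, a rainbow tree through three vertices contains a spider for
  -- them, centred at their median in the tree.
  module _ (T : Tree G) (T-rainbow : Rainbow c T) where

    OnT : Edge → Set
    OnT e = e ∈ edges T ⊎ swap e ∈ edges T

    treeWalk : ∀ {u v} → Linked (edges T) u v → Σ[ W ∈ Walk G u v ] All OnT (edgesW W)
    treeWalk here = here , []
    treeWalk (fwd e∈T p) with W , W-onT ← treeWalk p =
      step (proj₁ (All.lookup (edges-ok T) e∈T)) W , inj₁ e∈T ∷ W-onT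
    treeWalk (bwd e∈T p) with W , W-onT ← treeWalk p =
      step (sym G (proj₁ (All.lookup (edges-ok T) e∈T))) W , inj₂ e∈T ∷ W-onT

    onT-representative : ∀ {e} → OnT e → Σ[ t ∈ Edge ] (t ∈ edges T × SameEdge e t × colour e ≡ colour t)
    onT-representative (inj₁ e∈T) = _ , e∈T , sameEdge-refl , refl
    onT-representative (inj₂ e′∈T) =
      _ , e′∈T , inj₂ (refl , refl) , ≡-sym (col-sym c (proj₁ (All.lookup (edges-ok T) e′∈T)))

    onT-separated : ∀ {e f} → OnT e → OnT f → ¬ SameEdge e f → colour e ≢ colour f
    onT-separated e-onT f-onT ¬same same-colour
      with t , t∈T , e≈t , ce≡ct ← onT-representative e-onT
         | t′ , t′∈T , f≈t′ , cf≡ct′ ← onT-representative f-onT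
      with map-injectiveOn T-rainbow t∈T t′∈T (trans (≡-sym ce≡ct) (trans same-colour cf≡ct′))
    ... | refl = ¬same (sameEdge-trans e≈t (sameEdge-sym f≈t′))

    -- Take the tree path P from b to a; let R be the tree path from d to
    -- the first vertex m it meets on P, and split P at m into A (b to m)
    -- and B (m to a).  Then reverse B, A and R are walks to m in T without
    -- a common edge, hence with pairwise distinct colours.
    rainbowTree⇒spider : ∀ {a b d} → a ∈ verts T → b ∈ verts T → d ∈ verts T → Spider a b d
    rainbowTree⇒spider {a} {b} {d} a∈T b∈T d∈T
      with Wb , Wb-onT ← treeWalk (connected T b∈T a∈T)
         | Wd , Wd-onT ← treeWalk (connected T d∈T a∈T)
      with pathTo P (here refl) P-simple _ P-onT ← eraseLoops (a ∷ []) Wb (here refl) Wb-onT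
      with pathTo R m∈P R-simple R-leaves R-onT ← eraseLoops (vertsW P) Wd (end∈ P) Wd-onT
      with A , B , P≡AB , _ ← splitWalk P m∈P
      = spider (reverseW B) A R (unique-resp-↭ permute ABR-rainbow)
      where
      -- R leaves P only through vertices off P, so it shares no edge with P.
      P⊥R : All (λ e → All (λ f → ¬ SameEdge e f) (edgesW R)) (edgesW P)
      P⊥R = All.tabulate λ e∈P → All.tabulate λ f∈R f≈e →
        let (e₁∈P , e₂∈P) = endpoints∈ P e∈P in
        All.lookup R-leaves f∈R
          ([ (λ eq → subst (_∈ vertsW P) (≡-sym eq) e₁∈P)
           , (λ eq → subst (_∈ vertsW P) (≡-sym eq) e₂∈P) ]′ (sameEdge-fst (sameEdge-sym f≈e)))

      PR-rainbow : Unique (map colour (edgesW P ++ edgesW R))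
      PR-rainbow = unique-map onT-separated (All.++⁺ P-onT R-onT)
        (AllPairs.++⁺ (simple⇒edges-distinct P P-simple) (simple⇒edges-distinct R R-simple) P⊥R)

      ABR-rainbow : Unique (coloursW A ++ coloursW B ++ coloursW R)
      ABR-rainbow = subst Unique (begin
        map colour (edgesW P ++ edgesW R)                  ≡⟨ cong (λ es → map colour (es ++ edgesW R)) P≡AB ⟩
        map colour ((edgesW A ++ edgesW B) ++ edgesW R)    ≡⟨ cong (map colour) (++-assoc (edgesW A) _ _) ⟩
        map colour (edgesW A ++ edgesW B ++ edgesW R)      ≡⟨ map-++ colour (edgesW A) _ ⟩
        coloursW A ++ map colour (edgesW B ++ edgesW R)    ≡⟨ cong (coloursW A ++_) (map-++ colour (edgesW B) _) ⟩
        coloursW A ++ coloursW B ++ coloursW R             ∎) PR-rainbow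
        where open ≡-Reasoning

      permute : coloursW A ++ coloursW B ++ coloursW R ↭ coloursW (reverseW B) ++ coloursW A ++ coloursW R
      permute = ↭-trans (shifts (coloursW A) (coloursW B)) (++⁺ʳ _ (↭-sym (coloursW-reverse B)))

-- c has a spider for every three (not necessarily distinct) vertices; this
-- is the invariant carried through the product construction.
HasSpiders : ∀ {G r} → Colouring G r → Set
HasSpiders {G} c = ∀ x y z → Colours.Spider G c x y z

SpiderColouring : Graph → ℕ → Set
SpiderColouring G r = Σ[ c ∈ Colouring G r ] HasSpiders c

spiders⇒3rainbow : ∀ {G r} (c : Colouring G r) → HasSpiders c → Is3Rainbow c
spiders⇒3rainbow {G} c spiders x y z _ = Colours.spider⇒rainbowTree G c (spiders x y z)

vertices : (G : Graph) → List (V G)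
vertices G = map (Inverse.to (finite G)) (allFin (order G))

∈-vertices : (G : Graph) (v : V G) → v ∈ vertices G
∈-vertices G v = subst (_∈ vertices G) (Inverse.strictlyInverseˡ (finite G) v)
  (∈-map⁺ (Inverse.to (finite G)) (∈-allFin (Inverse.from (finite G) v)))

module _ (G : Graph) (G-connected : Connected G) where

  -- Two distinct vertices of a connected graph either have a third vertex
  -- besides them, or they are all of G and hence adjacent.
  third-vertex-or-edge : ∀ {p q} → p ≢ q → Σ[ w ∈ V G ] (p ≢ w × q ≢ w) ⊎ Adj G p q
  third-vertex-or-edge {p} {q} p≢q
    with any? (λ w → ¬? (_≟V_ G p w) ×-dec ¬? (_≟V_ G q w)) (vertices G)
  ... | yes third = inj₁ (satisfied third)
  ... | no  none  with G-connected p q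
  ...   | here = ⊥-elim (p≢q refl)
  ...   | step {w = w} p~w _ with _≟V_ G q w
  ...     | yes refl = inj₂ p~w
  ...     | no  q≢w  = ⊥-elim (none (lose (∈-vertices G w) (p≢w , q≢w)))
    where
    p≢w : p ≢ w
    p≢w refl = irrefl G p~w

  3rainbow⇒spiders : ∀ {r} (c : Colouring G r) → Is3Rainbow c → HasSpiders c
  3rainbow⇒spiders c 3rainbow = spiders
    where
    open Colours G c

    fromTree : ∀ {x y z} → Σ[ T ∈ Tree G ] (Contains3 T x y z × Rainbow c T) → Spider x y z
    fromTree (T , (x∈T , y∈T , z∈T) , T-rainbow) = rainbowTree⇒spider T T-rainbow x∈T y∈T z∈T

    pairSpider : ∀ p q → Spider p p q
    pairSpider p q with _≟V_ G p q
    ... | yes refl = spider here here here []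
    ... | no  p≢q with third-vertex-or-edge p≢q
    ...   | inj₂ p~q = spider here here (step (sym G p~q) here) ([] ∷ [])
    ...   | inj₁ (w , p≢w , q≢w) with T , (p∈T , q∈T , _) , T-rainbow ← 3rainbow p q w (p≢q , p≢w , q≢w)
      = rainbowTree⇒spider T T-rainbow p∈T p∈T q∈T

    spiders : HasSpiders c
    spiders x y z with _≟V_ G x y | _≟V_ G x z | _≟V_ G y z
    ... | yes refl | _        | _        = pairSpider x z
    ... | no  _    | yes refl | _        = spider-swap₂₃ (pairSpider x y)
    ... | no  _    | no  _    | yes refl = spider-swap₁₂ (spider-swap₂₃ (pairSpider y x))
    ... | no  x≢y  | no  x≢z  | no  y≢z  = fromTree (3rainbow x y z (x≢y , x≢z , y≢z))

-- Renaming the colours of c along f; if f is injective, spiders of c remain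
-- spiders (this embeds r colours into r + 0 for a one-factor product).
recolour : ∀ {G n m} → (Fin n → Fin m) → Colouring G n → Colouring G m
recolour f c = record { col = λ u v → f (col c u v) ; col-sym = λ a → cong f (col-sym c a) }

recolour-spiders : ∀ {G n m} (f : Fin n → Fin m) → (∀ {i j} → f i ≡ f j → i ≡ j) →
                   (c : Colouring G n) → HasSpiders c → HasSpiders (recolour f c)
recolour-spiders {G} f f-injective c spiders x y z = recoloured (spiders x y z)
  where
  open Walks G
  module C = Colours G c
  module C′ = Colours G (recolour f c)

  coloursW-recolour : ∀ {u v} (W : Walk G u v) → C′.coloursW W ≡ map f (C.coloursW W)
  coloursW-recolour W = map-∘ (edgesW W)

  recoloured : C.Spider x y z → C′.Spider x y z
  recoloured (C.spider W₁ W₂ W₃ rb) = C′.spider W₁ W₂ W₃ (subst Unique (≡-sym (begin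
    C′.coloursW W₁ ++ C′.coloursW W₂ ++ C′.coloursW W₃
      ≡⟨ cong₂ _++_ (coloursW-recolour W₁) (cong₂ _++_ (coloursW-recolour W₂) (coloursW-recolour W₃)) ⟩
    map f (C.coloursW W₁) ++ map f (C.coloursW W₂) ++ map f (C.coloursW W₃)
      ≡⟨ cong (map f (C.coloursW W₁) ++_) (map-++ f (C.coloursW W₂) _) ⟨
    map f (C.coloursW W₁) ++ map f (C.coloursW W₂ ++ C.coloursW W₃)
      ≡⟨ map-++ f (C.coloursW W₁) _ ⟨
    map f (C.coloursW W₁ ++ C.coloursW W₂ ++ C.coloursW W₃) ∎)) (Unique.map⁺ f-injective rb))
    where open ≡-Reasoning

↑ˡ≢↑ʳ : ∀ {a b} (i : Fin a) (j : Fin b) → i ↑ˡ b ≢ a ↑ʳ j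
↑ˡ≢↑ʳ {a} {b} i j eq
  with () ← trans (≡-sym (splitAt-↑ˡ a i b)) (trans (cong (splitAt a) eq) (splitAt-↑ʳ a b j))

blocks-disjoint : ∀ {a b} {xs : List (Fin b)} {ys : List (Fin a)} {v} →
                  v ∈ map (a ↑ʳ_) xs × v ∈ map (_↑ˡ b) ys → ⊥
blocks-disjoint {a} {b} (v∈xs , v∈ys) with ∈-map⁻ (a ↑ʳ_) v∈xs | ∈-map⁻ (_↑ˡ b) v∈ys
... | j , _ , refl | i , _ , eq = ↑ˡ≢↑ʳ i j (≡-sym eq)

interleave : ∀ {A : Set} (r₁ r₂ r₃ i₁ i₂ i₃ : List A) →
  (r₁ ++ r₂ ++ r₃) ++ (i₁ ++ i₂ ++ i₃) ↭ (r₁ ++ i₁) ++ (r₂ ++ i₂) ++ (r₃ ++ i₃)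
interleave {A} = solve 6 (λ r₁ r₂ r₃ i₁ i₂ i₃ →
    (r₁ ⊕ r₂ ⊕ r₃) ⊕ (i₁ ⊕ i₂ ⊕ i₃) ⊜ (r₁ ⊕ i₁) ⊕ (r₂ ⊕ i₂) ⊕ (r₃ ⊕ i₃)) ↭-refl
  where open import Algebra.Solver.CommutativeMonoid (++-commutativeMonoid {A = A})

module ProductColouring (G H : Graph) {a b : ℕ} (cG : Colouring G a) (cH : Colouring H b) where
  open Walks (G □ H) using (_++W_)

  product-col : V (G □ H) → V (G □ H) → Fin (a + b)
  product-col (g₁ , h₁) (g₂ , h₂) with _≟V_ G g₁ g₂
  ... | yes _ = a ↑ʳ col cH h₁ h₂
  ... | no  _ = col cG g₁ g₂ ↑ˡ b

  col-H-edge : ∀ g h₁ h₂ → product-col (g , h₁) (g , h₂) ≡ a ↑ʳ col cH h₁ h₂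
  col-H-edge g h₁ h₂ with _≟V_ G g g
  ... | yes _   = refl
  ... | no  g≢g = ⊥-elim (g≢g refl)

  col-G-edge : ∀ {g₁ g₂} h₁ h₂ → Adj G g₁ g₂ → product-col (g₁ , h₁) (g₂ , h₂) ≡ col cG g₁ g₂ ↑ˡ b
  col-G-edge {g₁} {g₂} h₁ h₂ g₁~g₂ with _≟V_ G g₁ g₂
  ... | yes refl = ⊥-elim (irrefl G g₁~g₂)
  ... | no  _    = refl

  product-col-sym : ∀ {u v} → Adj (G □ H) u v → product-col u v ≡ product-col v u
  product-col-sym {g , h₁} {_ , h₂} (inj₁ (refl , h₁~h₂)) = begin
    product-col (g , h₁) (g , h₂)  ≡⟨ col-H-edge g h₁ h₂ ⟩
    a ↑ʳ col cH h₁ h₂              ≡⟨ cong (a ↑ʳ_) (col-sym cH h₁~h₂) ⟩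
    a ↑ʳ col cH h₂ h₁              ≡⟨ col-H-edge g h₂ h₁ ⟨
    product-col (g , h₂) (g , h₁)  ∎
    where open ≡-Reasoning
  product-col-sym {g₁ , h} {g₂ , _} (inj₂ (refl , g₁~g₂)) = begin
    product-col (g₁ , h) (g₂ , h)  ≡⟨ col-G-edge h h g₁~g₂ ⟩
    col cG g₁ g₂ ↑ˡ b              ≡⟨ cong (_↑ˡ b) (col-sym cG g₁~g₂) ⟩
    col cG g₂ g₁ ↑ˡ b              ≡⟨ col-G-edge h h (sym G g₁~g₂) ⟨
    product-col (g₂ , h) (g₁ , h)  ∎
    where open ≡-Reasoning

  colouring : Colouring (G □ H) (a + b)
  colouring = record { col = product-col ; col-sym = product-col-sym }

  module CG = Colours G cG
  module CH = Colours H cH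
  module C  = Colours (G □ H) colouring

  inLayerG : ∀ {u v} (h : V H) → Walk G u v → Walk (G □ H) (u , h) (v , h)
  inLayerG h here       = here
  inLayerG h (step a W) = step (inj₂ (refl , a)) (inLayerG h W)

  inLayerH : ∀ {u v} (g : V G) → Walk H u v → Walk (G □ H) (g , u) (g , v)
  inLayerH g here       = here
  inLayerH g (step a W) = step (inj₁ (refl , a)) (inLayerH g W)

  coloursW-inLayerG : ∀ {u v} h (W : Walk G u v) → C.coloursW (inLayerG h W) ≡ map (_↑ˡ b) (CG.coloursW W)
  coloursW-inLayerG h here       = refl
  coloursW-inLayerG h (step a W) = cong₂ _∷_ (col-G-edge h h a) (coloursW-inLayerG h W)

  coloursW-inLayerH : ∀ {u v} g (W : Walk H u v) → C.coloursW (inLayerH g W) ≡ map (a ↑ʳ_) (CH.coloursW W)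
  coloursW-inLayerH g here       = refl
  coloursW-inLayerH g (step {u} {w} _ W) = cong₂ _∷_ (col-H-edge g u w) (coloursW-inLayerH g W)

  product-spider : ∀ {gx gy gz hx hy hz} → CG.Spider gx gy gz → CH.Spider hx hy hz →
                   C.Spider (gx , hx) (gy , hy) (gz , hz)
  product-spider {gx} {gy} {gz} (CG.spider {m} A₁ A₂ A₃ A-rainbow) (CH.spider {m′} B₁ B₂ B₃ B-rainbow) =
    C.spider (leg gx B₁ A₁) (leg gy B₂ A₂) (leg gz B₃ A₃) (subst Unique (≡-sym legs-colours)
      (unique-resp-↭ (interleave Hc₁ Hc₂ Hc₃ Gc₁ Gc₂ Gc₃)
        (subst Unique (cong₂ _++_ (map-++₃ (a ↑ʳ_) (CH.coloursW B₁) (CH.coloursW B₂) (CH.coloursW B₃))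
                                  (map-++₃ (_↑ˡ b) (CG.coloursW A₁) (CG.coloursW A₂) (CG.coloursW A₃)))
          (Unique.++⁺ (Unique.map⁺ (↑ʳ-injective a _ _) B-rainbow)
                      (Unique.map⁺ (↑ˡ-injective b _ _) A-rainbow)
                      blocks-disjoint))))
    where
    leg : ∀ {h} g → Walk H h m′ → Walk G g m → Walk (G □ H) (g , h) (m , m′)
    leg g B A = inLayerH g B ++W inLayerG m′ A

    Hc₁ Hc₂ Hc₃ : List (Fin (a + b))
    Hc₁ = map (a ↑ʳ_) (CH.coloursW B₁)
    Hc₂ = map (a ↑ʳ_) (CH.coloursW B₂)
    Hc₃ = map (a ↑ʳ_) (CH.coloursW B₃)
    Gc₁ Gc₂ Gc₃ : List (Fin (a + b))
    Gc₁ = map (_↑ˡ b) (CG.coloursW A₁)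
    Gc₂ = map (_↑ˡ b) (CG.coloursW A₂)
    Gc₃ = map (_↑ˡ b) (CG.coloursW A₃)

    leg-colours : ∀ {h} g (B : Walk H h m′) (A : Walk G g m) →
                  C.coloursW (leg g B A) ≡ map (a ↑ʳ_) (CH.coloursW B) ++ map (_↑ˡ b) (CG.coloursW A)
    leg-colours g B A = trans (C.coloursW-++ (inLayerH g B) (inLayerG m′ A))
                              (cong₂ _++_ (coloursW-inLayerH g B) (coloursW-inLayerG m′ A))

    legs-colours : C.coloursW (leg gx B₁ A₁) ++ C.coloursW (leg gy B₂ A₂) ++ C.coloursW (leg gz B₃ A₃)
                   ≡ (Hc₁ ++ Gc₁) ++ (Hc₂ ++ Gc₂) ++ (Hc₃ ++ Gc₃)
    legs-colours = cong₂ _++_ (leg-colours gx B₁ A₁) (cong₂ _++_ (leg-colours gy B₂ A₂) (leg-colours gz B₃ A₃))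

    map-++₃ : ∀ {X Y : Set} (f : X → Y) xs ys zs → map f (xs ++ ys ++ zs) ≡ map f xs ++ map f ys ++ map f zs
    map-++₃ f xs ys zs = trans (map-++ f xs _) (cong (map f xs ++_) (map-++ f ys zs))


  product-spiders : HasSpiders cG → HasSpiders cH → HasSpiders colouring
  product-spiders G-spiders H-spiders (gx , hx) (gy , hy) (gz , hz) =
    product-spider (G-spiders gx gy gz) (H-spiders hx hy hz)

SteinerLowerBound : (G : Graph) → V G → V G → V G → ℕ → Set
SteinerLowerBound G x y z d = (T : Tree G) → Contains3 T x y z → d ≤ ∥ T ∥

module Projection (G H : Graph) where
  open Trees using (Edge; IsEdge; tree-through; tree-edges-unique)

  projG : List (Edge (G □ H)) → List (Edge G)
  projG [] = []
  projG (((g₁ , _) , (g₂ , _)) ∷ es) with _≟V_ G g₁ g₂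
  ... | yes _ = projG es
  ... | no  _ = (g₁ , g₂) ∷ projG es

  projH : List (Edge (G □ H)) → List (Edge H)
  projH [] = []
  projH (((g₁ , h₁) , (g₂ , h₂)) ∷ es) with _≟V_ G g₁ g₂
  ... | yes _ = (h₁ , h₂) ∷ projH es
  ... | no  _ = projH es

  length-proj : ∀ es → length (projG es) + length (projH es) ≡ length es
  length-proj [] = refl
  length-proj (((g₁ , _) , (g₂ , _)) ∷ es) with _≟V_ G g₁ g₂
  ... | yes _ = trans (+-suc (length (projG es)) _) (cong suc (length-proj es))
  ... | no  _ = cong suc (length-proj es)

  projG-ok : ∀ {es} → All (IsEdge (G □ H)) es → All (IsEdge G) (projG es)
  projG-ok {[]} [] = []
  projG-ok {((g₁ , _) , (g₂ , _)) ∷ _} (e-ok ∷ es-ok) with _≟V_ G g₁ g₂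
  ... | yes _     = projG-ok es-ok
  ... | no  g₁≢g₂ = G-edge e-ok ∷ projG-ok es-ok
    where
    G-edge : ∀ {h₁ h₂} → ProdAdj G H (g₁ , h₁) (g₂ , h₂) → Adj G g₁ g₂
    G-edge (inj₁ (g₁≡g₂ , _)) = ⊥-elim (g₁≢g₂ g₁≡g₂)
    G-edge (inj₂ (_ , g₁~g₂)) = g₁~g₂

  projH-ok : ∀ {es} → All (IsEdge (G □ H)) es → All (IsEdge H) (projH es)
  projH-ok {[]} [] = []
  projH-ok {((g₁ , _) , (g₂ , _)) ∷ _} (e-ok ∷ es-ok) with _≟V_ G g₁ g₂
  ... | yes refl = H-edge e-ok ∷ projH-ok es-ok
    where
    H-edge : ∀ {h₁ h₂} → ProdAdj G H (g₁ , h₁) (g₁ , h₂) → Adj H h₁ h₂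
    H-edge (inj₁ (_ , h₁~h₂)) = h₁~h₂
    H-edge (inj₂ (_ , g₁~g₁)) = ⊥-elim (irrefl G g₁~g₁)
  ... | no  _    = projH-ok es-ok

  ∈-projG : ∀ {es e} → e ∈ es →
            proj₁ (proj₁ e) ≡ proj₁ (proj₂ e) ⊎ (proj₁ (proj₁ e) , proj₁ (proj₂ e)) ∈ projG es
  ∈-projG {((g₁ , _) , (g₂ , _)) ∷ _} (here refl) with _≟V_ G g₁ g₂
  ... | yes g₁≡g₂ = inj₁ g₁≡g₂
  ... | no  _     = inj₂ (here refl)
  ∈-projG {((g₁ , _) , (g₂ , _)) ∷ _} (there e∈es) with ∈-projG e∈es | _≟V_ G g₁ g₂
  ... | inj₁ eq | _     = inj₁ eq
  ... | inj₂ p  | yes _ = inj₂ p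
  ... | inj₂ p  | no  _ = inj₂ (there p)

  ∈-projH : ∀ {es e} → e ∈ es → IsEdge (G □ H) e →
            proj₂ (proj₁ e) ≡ proj₂ (proj₂ e) ⊎ (proj₂ (proj₁ e) , proj₂ (proj₂ e)) ∈ projH es
  ∈-projH {((g₁ , h₁) , (g₂ , h₂)) ∷ es} (here refl) e-ok with _≟V_ G g₁ g₂
  ... | yes _     = inj₂ (here refl)
  ... | no  g₁≢g₂ = inj₁ (H-fixed e-ok)
    where
    H-fixed : ProdAdj G H (g₁ , h₁) (g₂ , h₂) → h₁ ≡ h₂
    H-fixed (inj₁ (g₁≡g₂ , _)) = ⊥-elim (g₁≢g₂ g₁≡g₂)
    H-fixed (inj₂ (h₁≡h₂ , _)) = h₁≡h₂
  ∈-projH {((g₁ , _) , (g₂ , _)) ∷ _} (there e∈es) e-ok with ∈-projH e∈es e-ok | _≟V_ G g₁ g₂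
  ... | inj₁ eq | _     = inj₁ eq
  ... | inj₂ p  | yes _ = inj₂ (there p)
  ... | inj₂ p  | no  _ = inj₂ p

  linked-projG : ∀ {es p q} → Linked es p q → Linked (projG es) (proj₁ p) (proj₁ q)
  linked-projG here = here
  linked-projG (fwd e∈es l) with ∈-projG e∈es
  ... | inj₁ refl = linked-projG l
  ... | inj₂ e′   = fwd e′ (linked-projG l)
  linked-projG (bwd e∈es l) with ∈-projG e∈es
  ... | inj₁ refl = linked-projG l
  ... | inj₂ e′   = bwd e′ (linked-projG l)

  linked-projH : ∀ {es} → All (IsEdge (G □ H)) es →
                 ∀ {p q} → Linked es p q → Linked (projH es) (proj₂ p) (proj₂ q)
  linked-projH es-ok here = here
  linked-projH es-ok (fwd e∈es l) with ∈-projH e∈es (All.lookup es-ok e∈es)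
  ... | inj₁ refl = linked-projH es-ok l
  ... | inj₂ e′   = fwd e′ (linked-projH es-ok l)
  linked-projH es-ok (bwd e∈es l) with ∈-projH e∈es (All.lookup es-ok e∈es)
  ... | inj₁ refl = linked-projH es-ok l
  ... | inj₂ e′   = bwd e′ (linked-projH es-ok l)

  -- The projected edges of a tree T of G □ H through x, y, z contain trees
  -- of G and of H through the projections; by the pigeonhole principle T
  -- has at least as many edges as these two trees together.
  tree-size-≥ : ∀ {x y z dG dH} →
    SteinerLowerBound G (proj₁ x) (proj₁ y) (proj₁ z) dG →
    SteinerLowerBound H (proj₂ x) (proj₂ y) (proj₂ z) dH →
    SteinerLowerBound (G □ H) x y z (dG + dH)
  tree-size-≥ {x} {y} {z} {dG} {dH} G-bound H-bound T (x∈T , y∈T , z∈T) =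
    count (tree-through G (projG (edges T)) (projG-ok T-ok)
             (linked-projG (to-x x∈T)) (linked-projG (to-x y∈T)) (linked-projG (to-x z∈T)))
          (tree-through H (projH (edges T)) (projH-ok T-ok)
             (linked-projH T-ok (to-x x∈T)) (linked-projH T-ok (to-x y∈T)) (linked-projH T-ok (to-x z∈T)))
    where
    T-ok : All (IsEdge (G □ H)) (edges T)
    T-ok = All.map proj₁ (edges-ok T)

    to-x : ∀ {v} → v ∈ verts T → Linked (edges T) v x
    to-x v∈T = connected T v∈T x∈T

    count : Σ[ TG ∈ Tree G ] (Contains3 TG (proj₁ x) (proj₁ y) (proj₁ z) × All (_∈ projG (edges T)) (edges TG)) →
            Σ[ TH ∈ Tree H ] (Contains3 TH (proj₂ x) (proj₂ y) (proj₂ z) × All (_∈ projH (edges T)) (edges TH)) →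
            dG + dH ≤ ∥ T ∥
    count (TG , TG∋ , TG⊆) (TH , TH∋ , TH⊆) = subst (dG + dH ≤_) (length-proj (edges T))
      (+-mono-≤ (≤-trans (G-bound TG TG∋) (unique-length-≤ (tree-edges-unique G TG) TG⊆))
                (≤-trans (H-bound TH TH∋) (unique-length-≤ (tree-edges-unique H TH) TH⊆)))

product-spiderColouring : ∀ {n} (Gs : Vec Graph (suc n)) (rs : Vec ℕ (suc n)) →
  ((i : Fin (suc n)) → SpiderColouring (lookup Gs i) (lookup rs i)) → SpiderColouring (□⋆ Gs) (sum rs)
product-spiderColouring (G ∷ []) (r ∷ []) factor
  with c , c-spiders ← factor zero
  = recolour (_↑ˡ 0) c , recolour-spiders (_↑ˡ 0) (↑ˡ-injective 0 _ _) c c-spiders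
product-spiderColouring (G ∷ H ∷ Gs) (r ∷ rs) factor
  with c , c-spiders ← factor zero
     | c′ , c′-spiders ← product-spiderColouring (H ∷ Gs) rs (factor ∘ suc)
  = ProductColouring.colouring G (□⋆ (H ∷ Gs)) c c′ ,
    ProductColouring.product-spiders G (□⋆ (H ∷ Gs)) c c′ c-spiders c′-spiders

point : ∀ {n} (Gs : Vec Graph (suc n)) → ((i : Fin (suc n)) → V (lookup Gs i)) → V (□⋆ Gs)
point (G ∷ [])     f = f zero
point (G ∷ H ∷ Gs) f = f zero , point (H ∷ Gs) (f ∘ suc)

first : ∀ {n} (Gs : Vec Graph (suc n)) → V (□⋆ Gs) → V (lookup Gs zero)
first (G ∷ [])     v = v
first (G ∷ H ∷ Gs) v = proj₁ v

first-point : ∀ {n} (Gs : Vec Graph (suc n)) f → first Gs (point Gs f) ≡ f zero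
first-point (G ∷ [])     f = refl
first-point (G ∷ H ∷ Gs) f = refl

record DiametralTriple (G : Graph) (D : ℕ) : Set where
  field
    x y z         : V G
    xyz-distinct  : Distinct3 x y z
    steiner-bound : SteinerLowerBound G x y z D

diametral : ∀ {G D} → Sdiam3 G D → DiametralTriple G D
diametral ((x , y , z , xyz-distinct , _ , steiner-bound) , _) = record
  { x = x ; y = y ; z = z ; xyz-distinct = xyz-distinct ; steiner-bound = steiner-bound }

product-tree-size-≥ : ∀ {n} (Gs : Vec Graph (suc n)) (ds : Vec ℕ (suc n))
  (fx fy fz : (i : Fin (suc n)) → V (lookup Gs i)) →
  ((i : Fin (suc n)) → SteinerLowerBound (lookup Gs i) (fx i) (fy i) (fz i) (lookup ds i)) →
  SteinerLowerBound (□⋆ Gs) (point Gs fx) (point Gs fy) (point Gs fz) (sum ds)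
product-tree-size-≥ (G ∷ []) (d ∷ []) fx fy fz bound T T∋ =
  subst (_≤ ∥ T ∥) (≡-sym (+-identityʳ d)) (bound zero T T∋)
product-tree-size-≥ (G ∷ H ∷ Gs) (d ∷ ds) fx fy fz bound =
  Projection.tree-size-≥ G (□⋆ (H ∷ Gs)) (bound zero)
    (product-tree-size-≥ (H ∷ Gs) ds (fx ∘ suc) (fy ∘ suc) (fz ∘ suc) (bound ∘ suc))

rainbow-size-≤ : ∀ {G r} (c : Colouring G r) (T : Tree G) → Rainbow c T → ∥ T ∥ ≤ r
rainbow-size-≤ c T T-rainbow =
  subst₂ _≤_ (length-map (Colours.colour _ c) (edges T)) (length-tabulate id)
    (unique-length-≤ T-rainbow (All.tabulate (λ {i} _ → ∈-allFin i)))

-- If every factor has Steiner 3-diameter dᵢ, then every 3-rainbow colouring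
-- of the product uses at least Σ dᵢ colours: a rainbow tree through the
-- product of diametral triples has at least Σ dᵢ edges.
product-3rainbow-≥ : ∀ {n} (Gs : Vec Graph (suc n)) (ds : Vec ℕ (suc n)) →
  ((i : Fin (suc n)) → Sdiam3 (lookup Gs i) (lookup ds i)) →
  ∀ {r} (c : Colouring (□⋆ Gs) r) → Is3Rainbow c → sum ds ≤ r
product-3rainbow-≥ Gs ds sdiam {r} c 3rainbow =
  count (3rainbow (point Gs fx) (point Gs fy) (point Gs fz) distinct)
  where
  open DiametralTriple

  fx fy fz : (i : Fin _) → V (lookup Gs i)
  fx i = x (diametral (sdiam i))
  fy i = y (diametral (sdiam i))
  fz i = z (diametral (sdiam i))

  on-first : ∀ f g → point Gs f ≡ point Gs g → f zero ≡ g zero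
  on-first f g eq = trans (≡-sym (first-point Gs f)) (trans (cong (first Gs) eq) (first-point Gs g))

  -- the points are distinct because their first coordinates are
  distinct : Distinct3 (point Gs fx) (point Gs fy) (point Gs fz)
  distinct = let x≢y , x≢z , y≢z = xyz-distinct (diametral (sdiam zero)) in
    x≢y ∘ on-first fx fy , x≢z ∘ on-first fx fz , y≢z ∘ on-first fy fz

  count : Σ[ T ∈ Tree (□⋆ Gs) ] (Contains3 T (point Gs fx) (point Gs fy) (point Gs fz) × Rainbow c T) →
          sum ds ≤ r
  count (T , T∋ , T-rainbow) =
    ≤-trans (product-tree-size-≥ Gs ds fx fy fz (steiner-bound ∘ diametral ∘ sdiam) T T∋)
            (rainbow-size-≤ c T T-rainbow)

theorem6 : (k : ℕ) → 2 ≤ k → (Gs : Vec Graph k) → ((i : Fin k) → Connected (lookup Gs i)) →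
    (rs : Vec ℕ k) → ((i : Fin k) → Rx3 (lookup Gs i) (lookup rs i)) →
    (r : ℕ) → Rx3 (□⋆ Gs) r →
    (r ≤ sum rs) × (((i : Fin k) → Sdiam3 (lookup Gs i) (lookup rs i)) → r ≡ sum rs)
theorem6 zero ()
theorem6 (suc n) _ Gs Gs-connected rs rx r ((c , c-3rainbow) , minimal) = upper , equality
  where
  factor-spiders : (i : Fin (suc n)) → SpiderColouring (lookup Gs i) (lookup rs i)
  factor-spiders i with cᵢ , cᵢ-3rainbow ← proj₁ (rx i) =
    cᵢ , 3rainbow⇒spiders (lookup Gs i) (Gs-connected i) cᵢ cᵢ-3rainbow

  upper : r ≤ sum rs
  upper with c′ , c′-spiders ← product-spiderColouring Gs rs factor-spiders =
    minimal (sum rs) c′ (spiders⇒3rainbow c′ c′-spiders)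

  equality : ((i : Fin (suc n)) → Sdiam3 (lookup Gs i) (lookup rs i)) → r ≡ sum rs
  equality sdiam = ≤-antisym upper (product-3rainbow-≥ Gs rs sdiam c c-3rainbow)
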